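{- For every list $l$ of natural numbers and all $m, n, k \in \mathbb{N}$ with $k < m$, \[ \mathrm{next}_m\big([m]^n\,(k :: l)\big) = [k+1]^{n+1}\, l. \]
   Context: Lists of natural numbers: $[\,]$ is the empty list, $h :: t$ the list with head $h$ and tail $t$, juxtaposition denotes concatenation, and $[k]^i$ is the list consisting of $k$ repeated $i$ times. For $m \in \mathbb{N}$, the function $\mathrm{next}_m$ on lists is defined recursively by: $\mathrm{next}_m([\,]) = [0]$; $\mathrm{next}_m(h :: t) = (h+1) :: t$ if $h < m$; and if $h \ge m$: $\mathrm{next}_m(h :: t) = [\,]$ when $\mathrm{next}_m(t) = [\,]$, and $\mathrm{next}_m(h :: t) = x :: x :: t'$ when $\mathrm{next}_m(t) = x :: t'$. -}

module Defs where

open import Data.Nat using (ℕ; zero; suc; _<ᵇ_)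
open import Data.Bool using (Bool; true; false)
open import Data.List using (List; []; _∷_; _++_; replicate)

next-step : ℕ → List ℕ → List ℕ
next-step h [] = []
next-step h (x ∷ t′) = x ∷ x ∷ t′

-- next_m as in the paper:
--   next_m [] = [0]
--   next_m (h :: t) = (h+1) :: t                     if h < m
--   next_m (h :: t) = []            if h ≥ m and next_m t = []
--   next_m (h :: t) = x :: x :: t'  if h ≥ m and next_m t = x :: t'
next : ℕ → List ℕ → List ℕ
next m [] = 0 ∷ []
next m (h ∷ t) with h <ᵇ m
... | true  = suc h ∷ t
... | false = next-step h (next m t)

{-# OPTIONS --safe #-}
module Submission where

open import Defs
open import Data.Nat using (ℕ; suc; _<_; _≤_; _<ᵇ_)
open import Data.Nat.Properties using (<⇒<ᵇ; <ᵇ⇒<; ≤⇒≯; ≤-refl)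
open import Data.Bool using (true; false)
open import Data.List using (List; _∷_; _++_; replicate)
open import Relation.Binary.PropositionalEquality using (_≡_; refl; cong; module ≡-Reasoning)
open import Relation.Nullary using (contradiction)

next-< : ∀ {m h} {t : List ℕ} → h < m → next m (h ∷ t) ≡ suc h ∷ t
next-< {m} {h} h<m with h <ᵇ m | <⇒<ᵇ h<m
... | true | _ = refl

next-≥ : ∀ {m h} {t : List ℕ} → m ≤ h → next m (h ∷ t) ≡ next-step h (next m t)
next-≥ {m} {h} m≤h with h <ᵇ m | <ᵇ⇒< h m
... | false | _   = refl
... | true  | h<m = contradiction (h<m _) (≤⇒≯ m≤h)

lemma2 : (l : List ℕ) (m n k : ℕ) → k < m →
         next m (replicate n m ++ (k ∷ l)) ≡ replicate (suc n) (suc k) ++ l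
lemma2 l m 0       k k<m = next-< k<m
lemma2 l m (suc n) k k<m = begin
  next m (m ∷ replicate n m ++ k ∷ l)
    ≡⟨ next-≥ {t = replicate n m ++ k ∷ l} ≤-refl ⟩
  next-step m (next m (replicate n m ++ k ∷ l))
    ≡⟨ cong (next-step m) (lemma2 l m n k k<m) ⟩
  replicate (suc (suc n)) (suc k) ++ l
    ∎
  where open ≡-Reasoning
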